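{- Let $\mathcal{C}$ be a class of $\{0,1\}$-valued functions over a domain $X$ and $f\in\mathcal{C}^k$. If there exists a unique set $\{f_1,\dots,f_k\}\subseteq\mathcal{C}$ such that $f=f_1\wedge\dots\wedge f_k$, then for each $i=1,\dots,k$, $$ S(f_i,\mathcal{C})\subseteq\bigcap_{j\neq i}M_1(f_j). $$
   Context: $M_\nu(f)=\{x\in X: f(x)=\nu\}$. $\mathcal{C}^k$ is the class of functions that can be written as a conjunction of $k$ functions from $\mathcal{C}$. For a class $\mathcal{D}$ and $g\in\mathcal{D}$, a point $x\in X$ is essential for $g$ with respect to $\mathcal{D}$ if there is $h\in\mathcal{D}$ with $h(x)\neq g(x)$ and $h=g$ on $X\setminus\{x\}$; $S(g,\mathcal{D})$ is the set of essential points. -}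

module Defs where

open import Level using (Level; _⊔_)
open import Data.Bool using (Bool; true; false; _∧_)
open import Data.Nat using (ℕ; zero; suc)
open import Data.Fin using (Fin; zero; suc)
open import Data.Product using (Σ; _×_; ∃-syntax)
open import Relation.Binary.PropositionalEquality using (_≡_; _≢_; _≗_)

-- {0,1}-valued functions on X are X → Bool, with true = 1, false = 0.

M : ∀ {a} {X : Set a} → Bool → (X → Bool) → X → Set
M ν f x = f x ≡ ν

conj : ∀ {a} {X : Set a} {k : ℕ} → (Fin k → X → Bool) → X → Bool
conj {k = zero}  fs x = true
conj {k = suc k} fs x = fs zero x ∧ conj (λ i → fs (suc i)) x

Essential : ∀ {a ℓ} {X : Set a} → (g : X → Bool) → (D : (X → Bool) → Set ℓ) → X → Set (a ⊔ ℓ)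
Essential {X = X} g D x =
  ∃[ h ] (D h × (h x ≢ g x) × (∀ (y : X) → y ≢ x → h y ≡ g y))

SameSet : ∀ {a} {X : Set a} {k : ℕ} → (Fin k → X → Bool) → (Fin k → X → Bool) → Set a
SameSet {k = k} gs fs =
  (∀ (i : Fin k) → ∃[ j ] (gs i ≗ fs j)) × (∀ (j : Fin k) → ∃[ i ] (fs j ≗ gs i))

module Submission where

-- Say f = f₁ ∧ … ∧ f_k is the unique decomposition, x is
-- essential for f_i (witnessed by h ∈ C, differing from f_i exactly at x), and
-- some conjunct f_j with j ≠ i vanishes at x.  Changing conjuncts at the single
-- point x is then invisible in the conjunction, because f_j already kills it.
--
--  * Rigidity: an essential point x of a conjunct f_c forces f_c(x) = 0.
--    Otherwise replace every copy of f_c by its witness p (p(x) = 0); the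
--    conjunction is unchanged, so by uniqueness f_c must reappear among the
--    remaining conjuncts, i.e. there is one more copy of f_c.  Iterating, the
--    set of copies grows without bound inside {1,…,k}, which is absurd.
--  * Witnesses are conjuncts: replacing f_i by h keeps the conjunction, so by
--    uniqueness h = f_m for some m.
--  * Then x is essential for both f_i and f_m = h, so f_i(x) = 0 = h(x) by
--    rigidity, contradicting h(x) ≠ f_i(x).  Hence f_j(x) = 1.

open import Defs
open import Level using (_⊔_)
open import Data.Bool using (Bool; true; false; _∧_; if_then_else_)
open import Data.Bool.Properties using (∧-zeroʳ; ¬-not) renaming (_≟_ to _≟ᵇ_)
open import Data.Nat using (ℕ; zero; suc; _≤_; z≤n; s≤s)
open import Data.Nat.Properties using (≤-trans; 1+n≰n)
open import Data.Fin using (Fin; zero; suc)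
open import Data.Fin.Subset using (Subset; _∈_; _∉_; _⊂_; ⁅_⁆; _∪_; ∣_∣)
  renaming (⊥ to ∅)
open import Data.Fin.Subset.Properties
  using (_∈?_; ∉⊥; x∈⁅x⁆; x∈⁅y⁆⇒x≡y; x∈p∪q⁺; x∈p∪q⁻; q⊆p∪q; ∣p∣≤n; p⊂q⇒∣p∣<∣q∣)
open import Data.Product using (_×_; _,_; proj₁; proj₂; ∃-syntax)
open import Data.Sum using (inj₁; inj₂)
open import Relation.Nullary using (does; yes; no; contradiction)
open import Relation.Nullary.Decidable using (decidable-stable)
open import Relation.Binary.PropositionalEquality
  using (_≡_; _≢_; _≗_; refl; sym; trans; cong₂)

-- Two Boolean functions that agree off x and at x agree everywhere.  No
-- decidable equality on X is needed: Boolean equality is stable.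
agree-off-and-at : ∀ {a} {X : Set a} {u v : X → Bool} (x : X) →
  (∀ y → y ≢ x → u y ≡ v y) → u x ≡ v x → u ≗ v
agree-off-and-at {u = u} {v} x off at y =
  decidable-stable (u y ≟ᵇ v y) λ u≢v → u≢v (off y λ { refl → u≢v at })

conj-cong : ∀ {a} {X : Set a} {k : ℕ} (gs fs : Fin k → X → Bool) (y : X) →
  (∀ l → gs l y ≡ fs l y) → conj gs y ≡ conj fs y
conj-cong {k = zero}  gs fs y e = refl
conj-cong {k = suc k} gs fs y e =
  cong₂ _∧_ (e zero) (conj-cong (λ l → gs (suc l)) (λ l → fs (suc l)) y (λ l → e (suc l)))

conj-false : ∀ {a} {X : Set a} {k : ℕ} (fs : Fin k → X → Bool) (y : X) (j : Fin k) →
  fs j y ≡ false → conj fs y ≡ false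
conj-false fs y zero e rewrite e = refl
conj-false fs y (suc j) e
  rewrite conj-false (λ l → fs (suc l)) y j e = ∧-zeroʳ (fs zero y)

conj-agree-off : ∀ {a} {X : Set a} {k : ℕ} (gs fs : Fin k → X → Bool) (x : X) →
  (∀ y → y ≢ x → ∀ l → gs l y ≡ fs l y) →
  (j : Fin k) → gs j x ≡ false → fs j x ≡ false → conj gs ≗ conj fs
conj-agree-off gs fs x off j gjx fjx = agree-off-and-at x
  (λ y y≢x → conj-cong gs fs y (off y y≢x))
  (trans (conj-false gs x j gjx) (sym (conj-false fs x j fjx)))

replaceOn : ∀ {a} {X : Set a} {k : ℕ} → Subset k → (X → Bool) →
  (Fin k → X → Bool) → Fin k → X → Bool
replaceOn S p fs l = if does (l ∈? S) then p else fs l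

module _ {a} {X : Set a} {k : ℕ} (S : Subset k) (p : X → Bool) (fs : Fin k → X → Bool) where

  replaceOn-inside : ∀ {l} → l ∈ S → replaceOn S p fs l ≗ p
  replaceOn-inside {l} l∈S with l ∈? S
  ... | yes _   = λ _ → refl
  ... | no l∉S = contradiction l∈S l∉S

  replaceOn-outside : ∀ {l} → l ∉ S → replaceOn S p fs l ≗ fs l
  replaceOn-outside {l} l∉S with l ∈? S
  ... | yes l∈S = contradiction l∈S l∉S
  ... | no _    = λ _ → refl

  replaceOn-∈ : ∀ {ℓ} (C : (X → Bool) → Set ℓ) → C p → (∀ l → C (fs l)) →
    ∀ l → C (replaceOn S p fs l)
  replaceOn-∈ C Cp Cfs l with l ∈? S
  ... | yes _ = Cp
  ... | no _  = Cfs l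

  replaceOn-conj : (x : X) → (∀ {l} → l ∈ S → ∀ y → y ≢ x → p y ≡ fs l y) →
    (j : Fin k) → j ∉ S → fs j x ≡ false → conj fs ≗ conj (replaceOn S p fs)
  replaceOn-conj x p-off j j∉S fjx y = sym (conj-agree-off (replaceOn S p fs) fs x off j
    (trans (replaceOn-outside j∉S x) fjx) fjx y)
    where
    off : ∀ y → y ≢ x → ∀ l → replaceOn S p fs l y ≡ fs l y
    off y y≢x l with l ∈? S
    ... | yes l∈S = p-off l∈S y y≢x
    ... | no _    = refl

UniqueDecomposition : ∀ {a ℓ} {X : Set a} (C : (X → Bool) → Set ℓ) {k : ℕ} →
  (Fin k → X → Bool) → Set (a ⊔ ℓ)
UniqueDecomposition {X = X} C {k} fs =
  ∀ (gs : Fin k → X → Bool) → (∀ i → C (gs i)) → conj fs ≗ conj gs → SameSet gs fs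

module UniquelyDecomposed {a ℓ} {X : Set a} {C : (X → Bool) → Set ℓ} {k : ℕ}
    {fs : Fin k → X → Bool} (Cfs : ∀ i → C (fs i)) (unique : UniqueDecomposition C fs)
    (x : X) (j : Fin k) (fjx : fs j x ≡ false) where

  module Rigidity (c : Fin k) (fcx : fs c x ≡ true) (p : X → Bool) (Cp : C p)
      (px≢fcx : p x ≢ fs c x) (p-off : ∀ y → y ≢ x → p y ≡ fs c y) where

    Copies : Subset k → Set a
    Copies S = ∀ {l} → l ∈ S → fs l ≗ fs c

    j∉copies : ∀ {S} → Copies S → j ∉ S
    j∉copies copies j∈S with trans (sym fjx) (trans (copies j∈S x) fcx)
    ... | ()

    -- Replacing all copies by p and invoking uniqueness yields a new copy.
    grow : ∀ S → Copies S → ∃[ S′ ] Copies S′ × S ⊂ S′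
    grow S copies with proj₂ (unique gs Cgs same-conj) c
      where
      gs : Fin k → X → Bool
      gs = replaceOn S p fs
      Cgs : ∀ l → C (gs l)
      Cgs = replaceOn-∈ S p fs C Cp Cfs
      same-conj : conj fs ≗ conj gs
      same-conj = replaceOn-conj S p fs x
        (λ l∈S y y≢x → trans (p-off y y≢x) (sym (copies l∈S y))) j (j∉copies copies) fjx
    ... | n , fc≗gn with n ∈? S
    ...   | yes _   = contradiction (fc≗gn x)
                                    (λ fcx≡px → px≢fcx (sym fcx≡px))
    ...   | no n∉S = ⁅ n ⁆ ∪ S , copies′ , q⊆p∪q ⁅ n ⁆ S , n , x∈p∪q⁺ (inj₁ (x∈⁅x⁆ n)) , n∉S
      where
      fn≗fc : fs n ≗ fs c
      fn≗fc y = sym (fc≗gn y)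
      copies′ : Copies (⁅ n ⁆ ∪ S)
      copies′ {l} l∈S′ with x∈p∪q⁻ ⁅ n ⁆ S l∈S′
      ... | inj₁ l∈⁅n⁆ rewrite x∈⁅y⁆⇒x≡y n l∈⁅n⁆ = fn≗fc
      ... | inj₂ l∈S = copies l∈S

    copies-of-size : ∀ t → ∃[ S ] Copies S × t ≤ ∣ S ∣
    copies-of-size zero = ∅ , (λ l∈∅ → contradiction l∈∅ ∉⊥) , z≤n
    copies-of-size (suc t) with copies-of-size t
    ... | S , copies , t≤∣S∣ with grow S copies
    ...   | S′ , copies′ , S⊂S′ = S′ , copies′ , ≤-trans (s≤s t≤∣S∣) (p⊂q⇒∣p∣<∣q∣ S⊂S′)

  -- Rigidity: a set of more than k copies is impossible among k conjuncts.
  essential⇒false : ∀ c → Essential (fs c) C x → fs c x ≡ false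
  essential⇒false c (p , Cp , px≢fcx , p-off) = ¬-not λ fcx →
    let S , _ , k<∣S∣ = Rigidity.copies-of-size c fcx p Cp px≢fcx p-off (suc k)
    in 1+n≰n (≤-trans k<∣S∣ (∣p∣≤n S))

  witness-is-conjunct : ∀ i → j ≢ i → (h : X → Bool) → C h →
    (∀ y → y ≢ x → h y ≡ fs i y) → ∃[ m ] h ≗ fs m
  witness-is-conjunct i j≢i h Ch h-off with proj₁ (unique gs Cgs same-conj) i
    where
    gs : Fin k → X → Bool
    gs = replaceOn ⁅ i ⁆ h fs
    Cgs : ∀ l → C (gs l)
    Cgs = replaceOn-∈ ⁅ i ⁆ h fs C Ch Cfs
    same-conj : conj fs ≗ conj gs
    same-conj = replaceOn-conj ⁅ i ⁆ h fs x
      (λ l∈⁅i⁆ y y≢x → trans (h-off y y≢x) (cong-i (x∈⁅y⁆⇒x≡y i l∈⁅i⁆)))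
      j (λ j∈⁅i⁆ → j≢i (x∈⁅y⁆⇒x≡y i j∈⁅i⁆)) fjx
      where
      cong-i : ∀ {l y} → l ≡ i → fs i y ≡ fs l y
      cong-i refl = refl
  ... | m , gi≗fm =
    m , λ y → trans (sym (replaceOn-inside ⁅ i ⁆ h fs (x∈⁅x⁆ i) y)) (gi≗fm y)

proposition3 : ∀ {a ℓ} {X : Set a} (C : (X → Bool) → Set ℓ) (k : ℕ)
    (f : X → Bool) (fs : Fin k → X → Bool) →
    (∀ i → C (fs i)) → f ≗ conj fs →
    (∀ (gs : Fin k → X → Bool) → (∀ i → C (gs i)) → f ≗ conj gs → SameSet gs fs) →
    ∀ (i : Fin k) (x : X) → Essential (fs i) C x →
    ∀ (j : Fin k) → j ≢ i → M true (fs j) x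
proposition3 C k f fs Cfs f≗conj uniq i x (h , Ch , hx≢fix , h-off) j j≢i = ¬-not λ fjx →
  let open UniquelyDecomposed {C = C} Cfs unique x j fjx
      m , h≗fm = witness-is-conjunct i j≢i h Ch h-off
      x-essential-for-fm : Essential (fs m) C x
      x-essential-for-fm = fs i , Cfs i
        , (λ fix≡fmx → hx≢fix (trans (h≗fm x) (sym fix≡fmx)))
        , λ y y≢x → trans (sym (h-off y y≢x)) (h≗fm y)
  in hx≢fix (trans (h≗fm x) (trans (essential⇒false m x-essential-for-fm)
                                    (sym (essential⇒false i (h , Ch , hx≢fix , h-off)))))
  where
  unique : UniqueDecomposition C fs
  unique gs Cgs conj-fs≗conj-gs = uniq gs Cgs (λ y → trans (f≗conj y) (conj-fs≗conj-gs y))
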